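{- Let $2\leq b<c$ be integers and suppose $x=[0;a_1,a_2,\dots]$ is a Trott number in both base $b$ and base $c$. Then $b$ and $c$ belong to the same interval $[k^2+1,k^2+k]$ for some positive integer $k$. Furthermore, if $a_2$ has $l$ digits in base $b$ and $m$ digits in base $c$, then $2\leq m<l$.
   Context: A real number $x$ is a Trott number in base $b$ if $x\in(0,1)$ has an infinite continued fraction expansion $x=[0;a_1,a_2,\dots]$ with all $a_i$ positive integers and the base-$b$ expansion of $x$ is $(0.\hat{a}_1\hat{a}_2\hat{a}_3\dots)_b$, where $\hat{a}_i$ is the string of base-$b$ digits of $a_i$ (without leading zeros), concatenated. -}

module Defs where

open import Data.Nat using (ℕ; zero; suc; _+_; _*_; _≤_; _/_; _%_)
open import Data.List using (List; []; _∷_; _++_; [_]; take; foldl; length)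
open import Data.Product using (_×_; ∃-syntax)
open import Data.Sum using (_⊎_)

-- Base-b digits of n, most significant first, without leading zeros
-- (digits b 0 = []).  Only meaningful for b ≥ 2; for b < 2 we return [].
-- The first argument of 'go' is fuel; fuel n suffices since n / b < n.
digits : ℕ → ℕ → List ℕ
digits zero _ = []
digits (suc zero) _ = []
digits b@(suc (suc _)) n = go n n
  where
  go : ℕ → ℕ → List ℕ
  go zero _ = []
  go (suc f) zero = []
  go (suc f) m@(suc _) = go f (m / b) ++ [ m % b ]

-- A sequence of partial quotients: a n is a_n for n ≥ 1 (a 0 is ignored).
-- Concatenation of the base-b digit strings of a_1, …, a_n.
catDigits : ℕ → (ℕ → ℕ) → ℕ → List ℕ
catDigits b a zero = []
catDigits b a (suc n) = catDigits b a n ++ digits b (a (suc n))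

digitValue : ℕ → List ℕ → ℕ
digitValue b = foldl (λ acc d → acc * b + d) 0

-- D b a N : the integer formed by the first N base-b digits of
-- 0.â₁â₂â₃… ; the truncation of that base-b number to N digits is D/b^N.
-- (When every a_i ≥ 1, catDigits b a N has at least N digits.)
truncDigits : ℕ → (ℕ → ℕ) → ℕ → ℕ
truncDigits b a N = digitValue b (take N (catDigits b a N))

cfP : (ℕ → ℕ) → ℕ → ℕ
cfP a zero = 0
cfP a (suc zero) = 1
cfP a (suc (suc n)) = a (suc (suc n)) * cfP a (suc n) + cfP a n

cfQ : (ℕ → ℕ) → ℕ → ℕ
cfQ a zero = 1
cfQ a (suc zero) = a 1
cfQ a (suc (suc n)) = a (suc (suc n)) * cfQ a (suc n) + cfQ a n

-- The real number [0;a_1,a_2,…] lies in the closed interval between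
-- consecutive convergents p_n/q_n and p_{n+1}/q_{n+1}; the real number
-- (0.â₁â₂…)_b lies in [D_N/b^N, (D_N+1)/b^N].  Both families of intervals
-- shrink to a point, so the two reals are equal iff every interval of the
-- first family meets every interval of the second.  Written with
-- cross-multiplication in ℕ (all denominators are positive):
--   min(p_n/q_n, p_{n+1}/q_{n+1}) ≤ (D_N+1)/b^N  and
--   D_N/b^N ≤ max(p_n/q_n, p_{n+1}/q_{n+1}).
CFEqualsDigits : ℕ → (ℕ → ℕ) → Set
CFEqualsDigits b a = ∀ n N →
  let D = truncDigits b a N
      bN = b Data.Nat.^ N
  in ((cfP a n * bN ≤ (D + 1) * cfQ a n) ⊎ (cfP a (suc n) * bN ≤ (D + 1) * cfQ a (suc n)))
   × ((D * cfQ a n ≤ cfP a n * bN) ⊎ (D * cfQ a (suc n) ≤ cfP a (suc n) * bN))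

-- x = [0;a_1,a_2,…] (infinite, all a_i positive integers) is a Trott number
-- in base b: its base-b expansion is the concatenation â₁â₂â₃….
-- (Such x automatically lies in (0,1).)
IsTrott : ℕ → (ℕ → ℕ) → Set
IsTrott b a = (∀ i → 1 ≤ i → 1 ≤ a i) × CFEqualsDigits b a

{-# OPTIONS --safe #-}
-- Reading x in base B up to the end of â₁ and using x < 1/a₁ gives a₁² < B, so k = a₁ is a
-- single digit in both bases and k² < b.  Put A = a₂ with l digits in base b and m in base c.
-- Truncating after â₁â₂ and using x ≥ p₂/q₂ = A/(Ak+1) gives, in a base B where A has n digits,
--   A/(Ak+1) ≤ (kBⁿ + A + 1)/B^(n+1);
-- and since the intervals between consecutive convergents shrink faster than 1/n, the two
-- truncations of x are consistent:  (kbˡ + A)/b^(l+1) ≤ (kcᵐ + A + 1)/c^(m+1).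
-- Now m ≤ l as b < c, and consistency fails when m = l.  In base c the first inequality
-- gives A/(Ak+1) ≤ (k+1)/c, which for c > k² + k forces A ≤ k + 1; if m ≥ 2 then c ≤ A, so
-- c ≤ k² + k.  Finally m = 1 is impossible: for c ≤ k² + k the first inequality fails in
-- base b, and otherwise only k = 1, b = A = 2, c = 3 remains, where consistency fails.
module Submission where

open import Defs
open import Data.Nat
open import Data.Nat.Properties
open import Data.Nat.DivMod
open import Data.Nat.Tactic.RingSolver using (solve; solve-∀)
open import Data.List using (List; []; _∷_; _++_; [_]; length; foldl; take)
open import Data.List.Properties using (length-++; foldl-++; ++-assoc; ++-identityʳ)
open import Data.Product using (_×_; _,_; proj₁; proj₂; ∃-syntax)
open import Data.Sum using (_⊎_; inj₁; inj₂; swap)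
open import Data.Empty using (⊥)
open import Function using (_∘_)
open import Relation.Nullary using (Dec; yes; no; ¬_; contradiction)
open import Relation.Nullary.Decidable using (from-no)
open import Relation.Binary.PropositionalEquality hiding ([_])

-- Digit strings

record DigitString (B n : ℕ) (ds : List ℕ) : Set where
  field
    value      : digitValue B ds ≡ n
    n<B^length : n < B ^ length ds
    B^length≤  : 1 ≤ n → B ^ length ds ≤ n * B
    length≡0   : n ≡ 0 → length ds ≡ 0

DigitString-[] : ∀ {B} → DigitString B 0 []
DigitString-[] = record { value = refl ; n<B^length = s≤s z≤n ; B^length≤ = λ () ; length≡0 = λ _ → refl }

q*B≤n⇒B^length≤n : ∀ {B q n xs} → DigitString B q xs → 1 ≤ n → q * B ≤ n → B ^ length xs ≤ n
q*B≤n⇒B^length≤n {q = zero}  ds 1≤n _   rewrite DigitString.length≡0 ds refl = 1≤n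
q*B≤n⇒B^length≤n {q = suc _} ds _   qB≤n = ≤-trans (DigitString.B^length≤ ds (s≤s z≤n)) qB≤n

module _ {b' : ℕ} where
  private
    B : ℕ
    B = 2+ b'

  DigitString-snoc : ∀ {m xs} → DigitString B (suc m / B) xs →
                     DigitString B (suc m) (xs ++ [ suc m % B ])
  DigitString-snoc {m} {xs} ds = record
    { value = value′ ; n<B^length = upper ; B^length≤ = λ _ → lower ; length≡0 = λ () }
    where
    open DigitString ds
    q = suc m / B
    r = suc m % B
    L = length xs
    open ≤-Reasoning
    division : q * B + r ≡ suc m
    division = trans (+-comm (q * B) r) (sym (m≡m%n+[m/n]*n (suc m) B))
    length-snoc : length (xs ++ [ r ]) ≡ suc L
    length-snoc = trans (length-++ xs) (+-comm L 1)
    value′ : digitValue B (xs ++ [ r ]) ≡ suc m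
    value′ = trans (foldl-++ _ 0 xs [ r ]) (trans (cong (λ v → v * B + r) value) division)
    upper : suc m < B ^ length (xs ++ [ r ])
    upper rewrite length-snoc = begin-strict
      suc m      ≡⟨ sym division ⟩
      q * B + r  <⟨ +-monoʳ-< (q * B) (m%n<n (suc m) B) ⟩
      q * B + B  ≡⟨ +-comm (q * B) B ⟩
      suc q * B  ≤⟨ *-monoˡ-≤ B n<B^length ⟩
      B ^ L * B  ≡⟨ *-comm (B ^ L) B ⟩
      B ^ suc L  ∎
    lower : B ^ length (xs ++ [ r ]) ≤ suc m * B
    lower rewrite length-snoc = begin
      B * B ^ L  ≡⟨ *-comm B (B ^ L) ⟩
      B ^ L * B  ≤⟨ *-monoˡ-≤ B (q*B≤n⇒B^length≤n ds (s≤s z≤n) q*B≤suc-m) ⟩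
      suc m * B  ∎
      where
      q*B≤suc-m : q * B ≤ suc m
      q*B≤suc-m = ≤-trans (m≤m+n (q * B) r) (≤-reflexive division)

  quotient≤ : ∀ {m f} → m ≤ f → suc m / B ≤ f
  quotient≤ {m} m≤f = ≤-trans (<⇒≤pred (m/n<m (suc m) B (s≤s (s≤s z≤n)))) m≤f

module DigitLoop (b' : ℕ) (go : ℕ → ℕ → List ℕ)
  (go-no-fuel : ∀ m → go 0 m ≡ [])
  (go-zero    : ∀ f → go (suc f) 0 ≡ [])
  (go-step    : ∀ f m → go (suc f) (suc m) ≡ go f (suc m / 2+ b') ++ [ suc m % 2+ b' ]) where

  DigitString-go : ∀ f m → m ≤ f → DigitString (2+ b') m (go f m)
  DigitString-go zero    zero    _ rewrite go-no-fuel 0 = DigitString-[]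
  DigitString-go (suc f) zero    _ rewrite go-zero f = DigitString-[]
  DigitString-go (suc f) (suc m) (s≤s m≤f) rewrite go-step f m =
    DigitString-snoc (DigitString-go f (suc m / 2+ b') (quotient≤ m≤f))

-- `digits` runs a fuelled loop local to Defs, which cannot be named here.  It is obtained by
-- unification: abstracting suc k and its quotient exposes the loop applied to variables.
DigitString-digits : ∀ b' n → DigitString (2+ b') n (digits (2+ b') n)
DigitString-digits b' n with DigitLoop.DigitString-go b' _ (λ _ → refl) (λ _ → refl) (λ _ _ → refl)
DigitString-digits b' zero    | _ = DigitString-[]
DigitString-digits b' (suc k) | loop with suc k / 2+ b' in q≡ | suc k in n≡
... | q | n = snoc n≡ q≡ (loop k q (subst (_≤ k) q≡ (quotient≤ ≤-refl)))
  where
  snoc : ∀ {k n q xs} → suc k ≡ n → suc k / 2+ b' ≡ q → DigitString (2+ b') q xs →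
         DigitString (2+ b') n (xs ++ [ suc k % 2+ b' ])
  snoc refl refl = DigitString-snoc

module _ {b' : ℕ} where
  private
    B : ℕ
    B = 2+ b'

  digitValue-digits : ∀ n → digitValue B (digits B n) ≡ n
  digitValue-digits n = DigitString.value (DigitString-digits b' n)

  n<B^length : ∀ n → n < B ^ length (digits B n)
  n<B^length n = DigitString.n<B^length (DigitString-digits b' n)

  B^length≤ : ∀ {n} → 1 ≤ n → B ^ length (digits B n) ≤ n * B
  B^length≤ {n} = DigitString.B^length≤ (DigitString-digits b' n)

  1≤length-digits : ∀ {n} → 1 ≤ n → 1 ≤ length (digits B n)
  1≤length-digits {n} 1≤n with length (digits B n) | n<B^length n
  ... | zero  | n<1 = contradiction n<1 (≤⇒≯ 1≤n)
  ... | suc _ | _   = s≤s z≤n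

  base≤ : ∀ {n} → 2 ≤ length (digits B n) → B ≤ n
  base≤ {zero}  ()
  base≤ {suc n} 2≤length = *-cancelʳ-≤ B (suc n) B (begin
    B * B                          ≡⟨ cong (B *_) (sym (*-identityʳ B)) ⟩
    B ^ 2                          ≤⟨ ^-monoʳ-≤ B 2≤length ⟩
    B ^ length (digits B (suc n))  ≤⟨ B^length≤ {suc n} (s≤s z≤n) ⟩
    suc n * B                      ∎)
    where open ≤-Reasoning

  length-digits≡1 : ∀ {n} → 1 ≤ n → n < B → length (digits B n) ≡ 1
  length-digits≡1 1≤n n<B =
    ≤-antisym (≮⇒≥ (λ 1<length → <⇒≱ n<B (base≤ 1<length))) (1≤length-digits 1≤n)

  length-digits≤1 : ∀ {n} → n * n < B ^ length (digits B n) → length (digits B n) ≤ 1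
  length-digits≤1 {n} n²<B^length = ≮⇒≥ λ 1<length →
    let B≤n = base≤ 1<length in
    <⇒≱ n²<B^length (≤-trans (B^length≤ {n} (≤-trans (s≤s z≤n) B≤n)) (*-monoʳ-≤ n B≤n))

length-digits-antitone : ∀ {b' c'} n → 2+ b' ≤ 2+ c' →
                         length (digits (2+ c') n) ≤ length (digits (2+ b') n)
length-digits-antitone {b'} {c'} zero    _   = z≤n
length-digits-antitone {b'} {c'} (suc n) b≤c = ≮⇒≥ λ l<m → <⇒≱ (n<B^length (suc n)) (begin
  b ^ l                 ≤⟨ ^-monoˡ-≤ l b≤c ⟩
  c ^ l                 ≤⟨ *-cancelʳ-≤ (c ^ l) (suc n) c (begin
    c ^ l * c              ≡⟨ *-comm (c ^ l) c ⟩
    c ^ suc l              ≤⟨ ^-monoʳ-≤ c l<m ⟩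
    c ^ m                  ≤⟨ B^length≤ {n = suc n} (s≤s z≤n) ⟩
    suc n * c              ∎) ⟩
  suc n                 ∎)
  where
  open ≤-Reasoning
  b = 2+ b'
  c = 2+ c'
  l = length (digits b (suc n))
  m = length (digits c (suc n))

-- Truncations of the concatenated expansion

digitValue-++ : ∀ B xs ys → digitValue B (xs ++ ys) ≡ digitValue B xs * B ^ length ys + digitValue B ys
digitValue-++ B xs ys = trans (foldl-++ _ 0 xs ys) (shift (digitValue B xs) ys)
  where
  shift : ∀ z ys → foldl (λ acc d → acc * B + d) z ys ≡ z * B ^ length ys + digitValue B ys
  shift z []       = sym (trans (+-identityʳ (z * 1)) (*-identityʳ z))
  shift z (y ∷ ys) = begin
    foldl _ (z * B + y) ys                                          ≡⟨ shift (z * B + y) ys ⟩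
    (z * B + y) * B ^ length ys + digitValue B ys                   ≡⟨ regroup z y B (B ^ length ys) (digitValue B ys) ⟩
    z * (B * B ^ length ys) + (y * B ^ length ys + digitValue B ys) ≡⟨ cong (z * (B * B ^ length ys) +_) (shift y ys) ⟨
    z * (B * B ^ length ys) + foldl _ y ys                          ∎
    where
    open ≡-Reasoning
    regroup : ∀ z y B P R → (z * B + y) * P + R ≡ z * (B * P) + (y * P + R)
    regroup = solve-∀

catDigits-extends : ∀ B a m d → ∃[ ys ] catDigits B a (d + m) ≡ catDigits B a m ++ ys
catDigits-extends B a m zero    = [] , sym (++-identityʳ _)
catDigits-extends B a m (suc d) with catDigits-extends B a m d
... | ys , extends = ys ++ digits B (a (suc (d + m))) ,
                     trans (cong (_++ digits B (a (suc (d + m)))) extends) (++-assoc (catDigits B a m) ys _)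

take-length-++ : ∀ (xs ys : List ℕ) → take (length xs) (xs ++ ys) ≡ xs
take-length-++ []       ys = refl
take-length-++ (x ∷ xs) ys = cong (x ∷_) (take-length-++ xs ys)

AllPositive : (ℕ → ℕ) → Set
AllPositive a = ∀ i → 1 ≤ i → 1 ≤ a i

module _ {b' : ℕ} {a : ℕ → ℕ} (pos : AllPositive a) where
  private
    B : ℕ
    B = 2+ b'

  n≤length-catDigits : ∀ n → n ≤ length (catDigits B a n)
  n≤length-catDigits zero    = z≤n
  n≤length-catDigits (suc n) = begin
    suc n
      ≡⟨ +-comm 1 n ⟩
    n + 1
      ≤⟨ +-mono-≤ (n≤length-catDigits n) (1≤length-digits (pos (suc n) (s≤s z≤n))) ⟩
    length (catDigits B a n) + length (digits B (a (suc n)))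
      ≡⟨ length-++ (catDigits B a n) ⟨
    length (catDigits B a (suc n))
      ∎
    where open ≤-Reasoning

  truncDigits-catDigits : ∀ m → truncDigits B a (length (catDigits B a m)) ≡ digitValue B (catDigits B a m)
  truncDigits-catDigits m with m≤n⇒∃[o]m+o≡n (n≤length-catDigits m)
  ... | d , m+d≡N with catDigits-extends B a m d
  ... | ys , extends = cong (digitValue B) (begin
    take N (catDigits B a N)             ≡⟨ cong (take N ∘ catDigits B a) (trans (sym m+d≡N) (+-comm m d)) ⟩
    take N (catDigits B a (d + m))       ≡⟨ cong (take N) extends ⟩
    take N (catDigits B a m ++ ys)       ≡⟨ take-length-++ (catDigits B a m) ys ⟩
    catDigits B a m                      ∎)
    where
    open ≡-Reasoning
    N = length (catDigits B a m)

  truncDigits-first : truncDigits B a (length (digits B (a 1))) ≡ a 1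
  truncDigits-first = trans (truncDigits-catDigits 1) (digitValue-digits (a 1))

  truncDigits-second : length (digits B (a 1)) ≡ 1 →
                       truncDigits B a (suc (length (digits B (a 2)))) ≡ a 1 * B ^ length (digits B (a 2)) + a 2
  truncDigits-second first-length = begin
    truncDigits B a (suc (length d₂))
      ≡⟨ cong (truncDigits B a) length-d₁d₂ ⟨
    truncDigits B a (length (d₁ ++ d₂))
      ≡⟨ truncDigits-catDigits 2 ⟩
    digitValue B (d₁ ++ d₂)
      ≡⟨ digitValue-++ B d₁ d₂ ⟩
    digitValue B d₁ * B ^ length d₂ + digitValue B d₂
      ≡⟨ cong₂ (λ x y → x * B ^ length d₂ + y) (digitValue-digits (a 1)) (digitValue-digits (a 2)) ⟩
    a 1 * B ^ length d₂ + a 2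
      ∎
    where
    open ≡-Reasoning
    d₁ = digits B (a 1)
    d₂ = digits B (a 2)
    length-d₁d₂ : length (d₁ ++ d₂) ≡ suc (length d₂)
    length-d₁d₂ = trans (length-++ d₁) (cong (_+ length d₂) first-length)

-- Fractions and convergents

infix 4 [_/_]≤[_/_]

[_/_]≤[_/_] : ℕ → ℕ → ℕ → ℕ → Set
[ p / q ]≤[ r / s ] = p * s ≤ r * q

fraction-trans : ∀ {p q r s t u} .{{_ : NonZero s}} →
                 [ p / q ]≤[ r / s ] → [ r / s ]≤[ t / u ] → [ p / q ]≤[ t / u ]
fraction-trans {p} {q} {r} {s} {t} {u} ps≤rq ru≤ts = *-cancelˡ-≤ s (begin
  s * (p * u)  ≡⟨ solve (s ∷ p ∷ u ∷ []) ⟩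
  p * s * u    ≤⟨ *-monoˡ-≤ u ps≤rq ⟩
  r * q * u    ≡⟨ solve (r ∷ q ∷ u ∷ []) ⟩
  q * (r * u)  ≤⟨ *-monoʳ-≤ q ru≤ts ⟩
  q * (t * s)  ≡⟨ solve (q ∷ t ∷ s ∷ []) ⟩
  s * (t * q)  ∎)
  where open ≤-Reasoning

fraction<reciprocal : ∀ {x u p q} k .{{_ : NonZero u}} →
                      [ x / u ]≤[ p / q ] → k * p < q → k * x < u
fraction<reciprocal {x} {u} {p} {q} k xq≤pu kp<q = *-cancelʳ-< q (k * x) u (begin-strict
  k * x * q    ≡⟨ *-assoc k x q ⟩
  k * (x * q)  ≤⟨ *-monoʳ-≤ k xq≤pu ⟩
  k * (p * u)  ≡⟨ *-assoc k p u ⟨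
  k * p * u    <⟨ *-monoˡ-< u kp<q ⟩
  q * u        ≡⟨ *-comm q u ⟩
  u * q        ∎)
  where open ≤-Reasoning

fraction-gap : ∀ {x u y v p q p′ q′} → [ p / q ]≤[ y / v ] → [ x / u ]≤[ p′ / q′ ] →
               p′ * q ≤ p * q′ + 1 → y * u < x * v → q * q′ ≤ u * v
fraction-gap {x} {u} {y} {v} {p} {q} {p′} {q′} pv≤yq xq′≤p′u det gap =
  +-cancelˡ-≤ (q * q′ * (y * u)) _ _ (begin
  q * q′ * (y * u) + q * q′    ≡⟨ solve (q ∷ q′ ∷ y ∷ u ∷ []) ⟩
  q * q′ * (y * u + 1)         ≤⟨ *-monoʳ-≤ (q * q′) (≤-trans (≤-reflexive (+-comm (y * u) 1)) gap) ⟩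
  q * q′ * (x * v)             ≡⟨ solve (q ∷ q′ ∷ x ∷ v ∷ []) ⟩
  q * v * (x * q′)             ≤⟨ *-monoʳ-≤ (q * v) xq′≤p′u ⟩
  q * v * (p′ * u)             ≡⟨ solve (q ∷ v ∷ p′ ∷ u ∷ []) ⟩
  p′ * q * (u * v)             ≤⟨ *-monoˡ-≤ (u * v) det ⟩
  (p * q′ + 1) * (u * v)       ≡⟨ solve (p ∷ q′ ∷ u ∷ v ∷ []) ⟩
  q′ * u * (p * v) + u * v     ≤⟨ +-monoˡ-≤ (u * v) (*-monoʳ-≤ (q′ * u) pv≤yq) ⟩
  q′ * u * (y * q) + u * v     ≡⟨ solve (q′ ∷ u ∷ y ∷ q ∷ v ∷ []) ⟩
  q * q′ * (y * u) + u * v     ∎)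
  where open ≤-Reasoning

ConvergentBelow : (ℕ → ℕ) → ℕ → ℕ → ℕ → Set
ConvergentBelow a n y v = [ cfP a n / cfQ a n ]≤[ y / v ] ⊎ [ cfP a (suc n) / cfQ a (suc n) ]≤[ y / v ]

ConvergentAbove : (ℕ → ℕ) → ℕ → ℕ → ℕ → Set
ConvergentAbove a n x u = [ x / u ]≤[ cfP a n / cfQ a n ] ⊎ [ x / u ]≤[ cfP a (suc n) / cfQ a (suc n) ]

cf-det-step : ∀ α P Q p q → P * q ≡ p * Q + 1 → P * (α * Q + q) ≡ (α * P + p) * Q + 1
cf-det-step α P Q p q Pq≡pQ+1 = begin
  P * (α * Q + q)          ≡⟨ solve (α ∷ P ∷ Q ∷ q ∷ []) ⟩
  α * P * Q + P * q        ≡⟨ cong (α * P * Q +_) Pq≡pQ+1 ⟩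
  α * P * Q + (p * Q + 1)  ≡⟨ solve (α ∷ P ∷ Q ∷ p ∷ []) ⟩
  (α * P + p) * Q + 1      ∎
  where open ≡-Reasoning

cf-det : ∀ a n → cfP a (suc n) * cfQ a n ≡ cfP a n * cfQ a (suc n) + 1
               ⊎ cfP a n * cfQ a (suc n) ≡ cfP a (suc n) * cfQ a n + 1
cf-det a zero    = inj₁ refl
cf-det a (suc n) with cf-det a n
... | inj₁ Pq≡pQ+1 = inj₂ (cf-det-step (a (2+ n)) (cfP a (suc n)) (cfQ a (suc n)) (cfP a n) (cfQ a n) Pq≡pQ+1)
... | inj₂ pQ≡Pq+1 = inj₁ (begin
  (α * P + p) * Q      ≡⟨ *-comm (α * P + p) Q ⟩
  Q * (α * P + p)      ≡⟨ cf-det-step α Q P q p (trans (*-comm Q p) (trans pQ≡Pq+1 (cong (_+ 1) (*-comm P q)))) ⟩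
  (α * Q + q) * P + 1  ≡⟨ cong (_+ 1) (*-comm (α * Q + q) P) ⟩
  P * (α * Q + q) + 1  ∎)
  where
  open ≡-Reasoning
  α = a (2+ n)
  P = cfP a (suc n)
  Q = cfQ a (suc n)
  p = cfP a n
  q = cfQ a n

a₁*cfP-recurrence : ∀ a n → a 1 * cfP a (2+ n) ≡ a (2+ n) * (a 1 * cfP a (suc n)) + a 1 * cfP a n
a₁*cfP-recurrence a n = regroup (a 1) (a (2+ n)) (cfP a (suc n)) (cfP a n)
  where
  regroup : ∀ k α P p → k * (α * P + p) ≡ α * (k * P) + k * p
  regroup = solve-∀

a₁*cfP≤cfQ : ∀ a n → a 1 * cfP a n ≤ cfQ a n
a₁*cfP≤cfQ a zero          = ≤-trans (≤-reflexive (*-zeroʳ (a 1))) z≤n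
a₁*cfP≤cfQ a (suc zero)    = ≤-reflexive (*-identityʳ (a 1))
a₁*cfP≤cfQ a (2+ n) = begin
  a 1 * cfP a (2+ n)
    ≡⟨ a₁*cfP-recurrence a n ⟩
  a (2+ n) * (a 1 * cfP a (suc n)) + a 1 * cfP a n
    ≤⟨ +-mono-≤ (*-monoʳ-≤ (a (2+ n)) (a₁*cfP≤cfQ a (suc n))) (a₁*cfP≤cfQ a n) ⟩
  cfQ a (2+ n)
    ∎
  where open ≤-Reasoning

module _ {a : ℕ → ℕ} (pos : AllPositive a) where

  a≢0 : ∀ i → NonZero (a (suc i))
  a≢0 i = >-nonZero (pos (suc i) (s≤s z≤n))

  1≤cfQ : ∀ n → 1 ≤ cfQ a n
  1≤cfQ zero       = ≤-refl
  1≤cfQ (suc zero) = pos 1 (s≤s z≤n)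
  1≤cfQ (2+ n)     = ≤-trans (1≤cfQ n) (m≤n+m (cfQ a n) _)

  n<cfQ-suc : ∀ n → n < cfQ a (suc n)
  n<cfQ-suc zero    = pos 1 (s≤s z≤n)
  n<cfQ-suc (suc n) = ≤-trans (≤-reflexive (+-comm 1 (suc n))) (+-mono-≤
    (≤-trans (n<cfQ-suc n) (m≤n*m (cfQ a (suc n)) (a (2+ n)) {{a≢0 (suc n)}}))
    (1≤cfQ n))

  a₁*cfP<cfQ : ∀ n → a 1 * cfP a (2+ n) < cfQ a (2+ n)
  a₁*cfP<cfQ n = subst (_< cfQ a (2+ n)) (sym (a₁*cfP-recurrence a n)) (expanded n)
    where
    expanded : ∀ n → a (2+ n) * (a 1 * cfP a (suc n)) + a 1 * cfP a n < cfQ a (2+ n)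
    expanded zero    = +-mono-≤-< (*-monoʳ-≤ (a 2) (a₁*cfP≤cfQ a 1))
                                  (≤-<-trans (≤-reflexive (*-zeroʳ (a 1))) ≤-refl)
    expanded (suc n) = +-mono-<-≤ (*-monoʳ-< (a (3 + n)) {{a≢0 (2+ n)}} (a₁*cfP<cfQ n))
                                  (a₁*cfP≤cfQ a (suc n))

  ConvergentAbove⇒a₁*x<u : ∀ {n x u} .{{_ : NonZero u}} → ConvergentAbove a (2+ n) x u → a 1 * x < u
  ConvergentAbove⇒a₁*x<u {n} (inj₁ ≤pₙ)   = fraction<reciprocal (a 1) ≤pₙ (a₁*cfP<cfQ n)
  ConvergentAbove⇒a₁*x<u {n} (inj₂ ≤pₙ₊₁) = fraction<reciprocal (a 1) ≤pₙ₊₁ (a₁*cfP<cfQ (suc n))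

  below-smaller-convergent : ∀ {n y v} → [ cfP a n / cfQ a n ]≤[ cfP a (suc n) / cfQ a (suc n) ] →
                             ConvergentBelow a n y v → [ cfP a n / cfQ a n ]≤[ y / v ]
  below-smaller-convergent increasing (inj₁ pₙ≤) = pₙ≤
  below-smaller-convergent {n} {y} {v} increasing (inj₂ pₙ₊₁≤) =
    fraction-trans {cfP a n} {cfQ a n} {cfP a (suc n)} {cfQ a (suc n)} {y} {v}
                   {{>-nonZero (1≤cfQ (suc n))}} increasing pₙ₊₁≤

convergents-increase-at-2 : ∀ a → [ cfP a 2 / cfQ a 2 ]≤[ cfP a 3 / cfQ a 3 ]
convergents-increase-at-2 a = ≤-trans (m≤m+n _ 1) (≤-reflexive (sym (det₂ (a 1) (a 2) (a 3))))
  where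
  det₂ : ∀ k A α → (α * (A * 1 + 0) + 1) * (A * k + 1) ≡ (A * 1 + 0) * (α * (A * k + 1) + k) + 1
  det₂ = solve-∀

-- Since x/u ≤ max(p/q, p′/q′) and min(p/q, p′/q′) ≤ y/v, the excess of x/u over y/v is at
-- most |p′/q′ − p/q| = 1/(q q′) (cf-det), which is less than 1/(u v).
squeeze : ∀ {a n x u y v} → u * v < cfQ a n * cfQ a (suc n) →
          ConvergentAbove a n x u → ConvergentBelow a n y v → [ x / u ]≤[ y / v ]
squeeze {a} {n} {x} {u} {y} {v} uv<qq′ above below = ≮⇒≥ λ gap → separated gap above below
  where
  p = cfP a n
  q = cfQ a n
  p′ = cfP a (suc n)
  q′ = cfQ a (suc n)
  instance
    qq′≢0 : NonZero (q * q′)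
    qq′≢0 = >-nonZero (≤-<-trans z≤n uv<qq′)
    q≢0 : NonZero q
    q≢0 = m*n≢0⇒m≢0 q
    q′≢0 : NonZero q′
    q′≢0 = m*n≢0⇒n≢0 q
  ≤+1 : ∀ {i j} → i ≡ j + 1 ⊎ j ≡ i + 1 → i ≤ j + 1
  ≤+1 (inj₁ i≡j+1) = ≤-reflexive i≡j+1
  ≤+1 {i} {j} (inj₂ j≡i+1) = ≤-trans (m≤m+n i 1) (≤-trans (≤-reflexive (sym j≡i+1)) (m≤m+n j 1))
  p′q≤pq′+1 : p′ * q ≤ p * q′ + 1
  p′q≤pq′+1 = ≤+1 (cf-det a n)
  pq′≤p′q+1 : p * q′ ≤ p′ * q + 1
  pq′≤p′q+1 = ≤+1 (swap (cf-det a n))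
  separated : y * u < x * v → ConvergentAbove a n x u → ConvergentBelow a n y v → ⊥
  separated gap (inj₁ x≤p) (inj₁ p≤y) =
    <⇒≱ gap (fraction-trans {x} {u} {p} {q} {y} {v} x≤p p≤y)
  separated gap (inj₂ x≤p′) (inj₂ p′≤y) =
    <⇒≱ gap (fraction-trans {x} {u} {p′} {q′} {y} {v} x≤p′ p′≤y)
  separated gap (inj₂ x≤p′) (inj₁ p≤y) =
    <⇒≱ uv<qq′ (fraction-gap {x} {u} {y} {v} {p} {q} {p′} {q′} p≤y x≤p′ p′q≤pq′+1 gap)
  separated gap (inj₁ x≤p) (inj₂ p′≤y) = <⇒≱ uv<qq′ (≤-trans (≤-reflexive (*-comm q q′))
    (fraction-gap {x} {u} {y} {v} {p′} {q′} {p} {q} p′≤y x≤p pq′≤p′q+1 gap))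

truncations-consistent : ∀ {b c a} → IsTrott b a → IsTrott c a → ∀ N M →
                         [ truncDigits b a N / b ^ N ]≤[ truncDigits c a M + 1 / c ^ M ]
truncations-consistent {b} {c} {a} (pos , b-expansion) (_ , c-expansion) N M =
  squeeze {a} {n} {truncDigits b a N} {b ^ N} {truncDigits c a M + 1} {c ^ M}
          uv<qq′ (proj₂ (b-expansion n N)) (proj₁ (c-expansion n M))
  where
  n = b ^ N * c ^ M
  uv<qq′ : n < cfQ a n * cfQ a (suc n)
  uv<qq′ = <-≤-trans (n<cfQ-suc pos n) (m≤n*m (cfQ a (suc n)) (cfQ a n) {{>-nonZero (1≤cfQ pos n)}})

-- The inequalities of the two-base argument

module _ {b' : ℕ} {a : ℕ → ℕ} (trott : IsTrott (2+ b') a) where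
  private
    B : ℕ
    B = 2+ b'
    pos : AllPositive a
    pos = proj₁ trott

  a₁²<base : a 1 * a 1 < B
  a₁²<base = <-≤-trans a₁²<B^L (begin
    B ^ L  ≤⟨ ^-monoʳ-≤ B (length-digits≤1 {b'} {a 1} a₁²<B^L) ⟩
    B ^ 1  ≡⟨ *-identityʳ B ⟩
    B      ∎)
    where
    open ≤-Reasoning
    L = length (digits B (a 1))
    a₁²<B^L : a 1 * a 1 < B ^ L
    a₁²<B^L = subst (λ x → a 1 * x < B ^ L) (truncDigits-first pos)
      (ConvergentAbove⇒a₁*x<u pos {0} {truncDigits B a L} {B ^ L} {{m^n≢0 B L}} (proj₂ (proj₂ trott 2 L)))

  length-digits-a₁≡1 : length (digits B (a 1)) ≡ 1
  length-digits-a₁≡1 = length-digits≡1 (pos 1 (s≤s z≤n))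
    (≤-<-trans (m≤m*n (a 1) (a 1) {{a≢0 pos 0}}) a₁²<base)

  second-convergent≤truncation : let l = length (digits B (a 2)) in
    [ a 2 / a 2 * a 1 + 1 ]≤[ a 1 * B ^ l + a 2 + 1 / B * B ^ l ]
  second-convergent≤truncation = subst₂ (λ p D → [ p / a 2 * a 1 + 1 ]≤[ D + 1 / B * B ^ l ])
    (trans (+-identityʳ (a 2 * 1)) (*-identityʳ (a 2)))
    (truncDigits-second pos length-digits-a₁≡1)
    (below-smaller-convergent pos {2} {truncDigits B a (suc l) + 1} {B ^ suc l}
      (convergents-increase-at-2 a) (proj₁ (proj₂ trott 2 (suc l))))
    where l = length (digits B (a 2))

truncations-inconsistent-at-equal-length :
  ∀ {k A b c bˡ cˡ} .{{_ : NonZero k}} .{{_ : NonZero bˡ}} → b < c → bˡ ≤ cˡ → c ≤ cˡ →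
  ¬ [ k * bˡ + A / b * bˡ ]≤[ k * cˡ + A + 1 / c * cˡ ]
truncations-inconsistent-at-equal-length {k} {A} {b} {c} {bˡ} {cˡ} b<c bˡ≤cˡ c≤cˡ = <⇒≱ (begin-strict
  (k * cˡ + A + 1) * (b * bˡ)                    ≡⟨ solve (k ∷ cˡ ∷ A ∷ b ∷ bˡ ∷ []) ⟩
  k * cˡ * (b * bˡ) + b * bˡ + A * (b * bˡ)      <⟨ +-mono-<-≤ (+-monoʳ-< (k * cˡ * (b * bˡ)) bbˡ<kbˡcˡ)
                                                                (*-monoʳ-≤ A (*-mono-≤ (<⇒≤ b<c) bˡ≤cˡ)) ⟩
  k * cˡ * (b * bˡ) + k * bˡ * cˡ + A * (c * cˡ) ≡⟨ solve (k ∷ cˡ ∷ b ∷ bˡ ∷ A ∷ c ∷ []) ⟩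
  k * bˡ * cˡ * suc b + A * (c * cˡ)             ≤⟨ +-monoˡ-≤ (A * (c * cˡ)) (*-monoʳ-≤ (k * bˡ * cˡ) b<c) ⟩
  k * bˡ * cˡ * c + A * (c * cˡ)                 ≡⟨ solve (k ∷ bˡ ∷ cˡ ∷ c ∷ A ∷ []) ⟩
  (k * bˡ + A) * (c * cˡ)                        ∎)
  where
  open ≤-Reasoning
  bbˡ<kbˡcˡ : b * bˡ < k * bˡ * cˡ
  bbˡ<kbˡcˡ = begin-strict
    b * bˡ         <⟨ *-monoˡ-< bˡ (<-≤-trans b<c c≤cˡ) ⟩
    cˡ * bˡ        ≡⟨ *-comm cˡ bˡ ⟩
    bˡ * cˡ        ≤⟨ m≤n*m (bˡ * cˡ) k ⟩
    k * (bˡ * cˡ)  ≡⟨ *-assoc k bˡ cˡ ⟨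
    k * bˡ * cˡ    ∎

truncation≤round-up : ∀ {k A c cᵐ} → A < cᵐ → [ k * cᵐ + A + 1 / c * cᵐ ]≤[ k + 1 / c ]
truncation≤round-up {k} {A} {c} {cᵐ} A<cᵐ = begin
  (k * cᵐ + A + 1) * c    ≡⟨ solve (k ∷ cᵐ ∷ A ∷ c ∷ []) ⟩
  (k * cᵐ + (1 + A)) * c  ≤⟨ *-monoˡ-≤ c (+-monoʳ-≤ (k * cᵐ) A<cᵐ) ⟩
  (k * cᵐ + cᵐ) * c       ≡⟨ solve (k ∷ cᵐ ∷ c ∷ []) ⟩
  (k + 1) * (c * cᵐ)      ∎
  where open ≤-Reasoning

second-quotient≤k+1 : ∀ {k A c} → k * k + k < c → [ A / A * k + 1 ]≤[ k + 1 / c ] → A ≤ k + 1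
second-quotient≤k+1 {k} {A} {c} k²+k<c A/[Ak+1]≤[k+1]/c = +-cancelˡ-≤ (A * (k * k + k)) A (k + 1) (begin
  A * (k * k + k) + A        ≡⟨ solve (A ∷ k ∷ []) ⟩
  A * (1 + (k * k + k))      ≤⟨ *-monoʳ-≤ A k²+k<c ⟩
  A * c                      ≤⟨ A/[Ak+1]≤[k+1]/c ⟩
  (k + 1) * (A * k + 1)      ≡⟨ solve (A ∷ k ∷ []) ⟩
  A * (k * k + k) + (k + 1)  ∎)
  where open ≤-Reasoning

sextic-gap : ∀ κ → (κ * κ + 5 * κ + 6) * ((κ * κ + 5 * κ + 5) * (κ + 2) + 1)
                 < (κ * κ + 3 * κ + 3) * ((κ * κ + 4 * κ + 5) * (κ * κ + 4 * κ + 5))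
sextic-gap κ = <-≤-trans (m<m+n _ z<s) (≤-reflexive (sym expansion))
  where
  expansion : (κ * κ + 3 * κ + 3) * ((κ * κ + 4 * κ + 5) * (κ * κ + 4 * κ + 5))
            ≡ (κ * κ + 5 * κ + 6) * ((κ * κ + 5 * κ + 5) * (κ + 2) + 1)
              + (9 + κ * (50 + κ * (95 + κ * (86 + κ * (41 + κ * (10 + κ))))))
  expansion = solve (κ ∷ [])

-- Bounding k + s ≤ k² + k − 1 on the left and s ≥ k² − k + 1, bˡ ≥ (k² + 1)² on the right
-- leaves sextic-gap, written in κ = k − 2.
window-estimate : ∀ {k s bˡ} → 2 ≤ k → k * k < k + s → k + s < k * k + k →
                  (1 + k * k) * (1 + k * k) ≤ bˡ → (k + s + 1) * ((k + s) * k + 1) < s * bˡ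
window-estimate {k} 2≤k with m≤n⇒∃[o]m+o≡n 2≤k
... | κ , 2+κ≡k with trans (+-comm κ 2) 2+κ≡k
... | refl = estimate
  where
  estimate : ∀ {s bˡ} → k * k < k + s → k + s < k * k + k →
             (1 + k * k) * (1 + k * k) ≤ bˡ → (k + s + 1) * ((k + s) * k + 1) < s * bˡ
  estimate {s} {bˡ} k²<k+s k+s<k²+k [1+k²]²≤bˡ = begin-strict
    (k + s + 1) * ((k + s) * k + 1)                                    ≤⟨ *-mono-≤ (+-monoˡ-≤ 1 k+s≤)
                                                                                    (+-monoˡ-≤ 1 (*-monoˡ-≤ k k+s≤)) ⟩
    (κ * κ + 5 * κ + 5 + 1) * ((κ * κ + 5 * κ + 5) * k + 1)            ≡⟨ solve (κ ∷ []) ⟩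
    (κ * κ + 5 * κ + 6) * ((κ * κ + 5 * κ + 5) * (κ + 2) + 1)          <⟨ sextic-gap κ ⟩
    (κ * κ + 3 * κ + 3) * ((κ * κ + 4 * κ + 5) * (κ * κ + 4 * κ + 5))  ≡⟨ solve (κ ∷ []) ⟩
    (κ * κ + 3 * κ + 3) * ((1 + k * k) * (1 + k * k))                  ≤⟨ *-mono-≤ s≥ [1+k²]²≤bˡ ⟩
    s * bˡ                                                             ∎
    where
    open ≤-Reasoning
    k²+k≡ : k * k + k ≡ 1 + (κ * κ + 5 * κ + 5)
    k²+k≡ = solve (κ ∷ [])
    k+[κ²+3κ+3]≡1+k² : k + (κ * κ + 3 * κ + 3) ≡ 1 + k * k
    k+[κ²+3κ+3]≡1+k² = solve (κ ∷ [])
    k+s≤ : k + s ≤ κ * κ + 5 * κ + 5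
    k+s≤ = ≤-pred (≤-trans k+s<k²+k (≤-reflexive k²+k≡))
    s≥ : κ * κ + 3 * κ + 3 ≤ s
    s≥ = +-cancelˡ-≤ k _ s (≤-trans (≤-reflexive k+[κ²+3κ+3]≡1+k²) k²<k+s)

second-convergent-beyond-truncation :
  ∀ {k A b bˡ} → 2 ≤ k → k * k < b → b ≤ A → A < k * k + k → b * b ≤ bˡ →
  ¬ [ A / A * k + 1 ]≤[ k * bˡ + A + 1 / b * bˡ ]
second-convergent-beyond-truncation {k} {A} {b} {bˡ} 2≤k k²<b b≤A A<k²+k b²≤bˡ with m≤n⇒∃[o]m+o≡n k≤A
  where
  k≤A : k ≤ A
  k≤A = ≤-trans (m≤m*n k k {{>-nonZero (≤-trans (s≤s z≤n) 2≤k)}}) (<⇒≤ (<-≤-trans k²<b b≤A))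
... | s , refl = <⇒≱ (begin-strict
  (k * bˡ + (k + s) + 1) * ((k + s) * k + 1)
    ≡⟨ solve (k ∷ bˡ ∷ s ∷ []) ⟩
  (k + s) * (k * k * bˡ) + k * bˡ + (k + s + 1) * ((k + s) * k + 1)
    <⟨ +-monoʳ-< ((k + s) * (k * k * bˡ) + k * bˡ)
         (window-estimate 2≤k (<-≤-trans k²<b b≤A) A<k²+k (≤-trans (*-mono-≤ k²<b k²<b) b²≤bˡ)) ⟩
  (k + s) * (k * k * bˡ) + k * bˡ + s * bˡ
    ≡⟨ solve (k ∷ bˡ ∷ s ∷ []) ⟩
  (k + s) * ((1 + k * k) * bˡ)
    ≤⟨ *-monoʳ-≤ (k + s) (*-monoˡ-≤ bˡ k²<b) ⟩
  (k + s) * (b * bˡ)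
    ∎)
  where open ≤-Reasoning

-- The hypotheses force k = 1, b = A = 2, c = 3 and bˡ = 4, where the inequality reads 54 ≤ 48.
small-case-inconsistent : ∀ {k A b c bˡ} → k * k < b → 2 ≤ b → b ≤ A → A ≤ k + 1 →
                          [ A / A * k + 1 ]≤[ k + 1 / c ] → b < c → b * b ≤ bˡ → bˡ ≤ A * b →
                          ¬ [ k * bˡ + A / b * bˡ ]≤[ k * (c * 1) + A + 1 / c * (c * 1) ]
small-case-inconsistent {zero} k²<b 2≤b b≤A A≤1 _ _ _ _ _ = <⇒≱ (≤-trans 2≤b b≤A) A≤1
small-case-inconsistent {2+ κ} k²<b _ b≤A A≤k+1 _ _ _ _ _ =
  <⇒≱ (<-≤-trans k²<b (≤-trans b≤A A≤k+1)) (+-monoʳ-≤ (2+ κ) (s≤s z≤n))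
small-case-inconsistent {1} {A} {b} {c} {bˡ} _ 2≤b b≤A A≤2 2c≤6 b<c b²≤bˡ bˡ≤Ab
  with ≤-antisym (≤-trans b≤A A≤2) 2≤b
... | refl with ≤-antisym A≤2 b≤A
... | refl with ≤-antisym (*-cancelˡ-≤ 2 2c≤6) b<c
... | refl with ≤-antisym bˡ≤Ab b²≤bˡ
... | refl = from-no (54 ≤? 48)

module TwoBases {b' c' : ℕ} {a : ℕ → ℕ} (b<c : 2+ b' < 2+ c')
                (b-trott : IsTrott (2+ b') a) (c-trott : IsTrott (2+ c') a) where
  b c k A l m : ℕ
  b = 2+ b'
  c = 2+ c'
  k = a 1
  A = a 2
  l = length (digits b A)
  m = length (digits c A)

  1≤k : 1 ≤ k
  1≤k = proj₁ b-trott 1 (s≤s z≤n)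

  1≤A : 1 ≤ A
  1≤A = proj₁ b-trott 2 (s≤s z≤n)

  k²<b : k * k < b
  k²<b = a₁²<base b-trott

  consistent : [ k * b ^ l + A / b * b ^ l ]≤[ k * c ^ m + A + 1 / c * c ^ m ]
  consistent = subst₂ (λ D E → [ D / b * b ^ l ]≤[ E + 1 / c * c ^ m ])
    (truncDigits-second (proj₁ b-trott) (length-digits-a₁≡1 b-trott))
    (truncDigits-second (proj₁ c-trott) (length-digits-a₁≡1 c-trott))
    (truncations-consistent b-trott c-trott (suc l) (suc m))

  consistent-at : ∀ {j} → m ≡ j → [ k * b ^ l + A / b * b ^ l ]≤[ k * c ^ j + A + 1 / c * c ^ j ]
  consistent-at refl = consistent

  m<l : m < l
  m<l = ≤∧≢⇒< (length-digits-antitone A (<⇒≤ b<c)) m≢l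
    where
    c≤cˡ : c ≤ c ^ l
    c≤cˡ = ≤-trans (≤-reflexive (sym (*-identityʳ c))) (^-monoʳ-≤ c (1≤length-digits {b'} 1≤A))
    m≢l : m ≢ l
    m≢l m≡l = truncations-inconsistent-at-equal-length {{a≢0 (proj₁ b-trott) 0}} {{m^n≢0 b l}}
                b<c (^-monoˡ-≤ l (<⇒≤ b<c)) c≤cˡ (consistent-at m≡l)

  second-convergent≤[k+1]/c : [ A / A * k + 1 ]≤[ k + 1 / c ]
  second-convergent≤[k+1]/c =
    fraction-trans {A} {A * k + 1} {k * c ^ m + A + 1} {c * c ^ m} {k + 1} {c}
                   {{m*n≢0 c (c ^ m) {{_}} {{m^n≢0 c m}}}}
      (second-convergent≤truncation c-trott) (truncation≤round-up {k} {A} {c} (n<B^length A))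

  m≢1 : m ≢ 1
  m≢1 m≡1 = split (c ≤? k * k + k)
    where
    2≤l : 2 ≤ l
    2≤l = subst (_< l) m≡1 m<l
    b≤A : b ≤ A
    b≤A = base≤ 2≤l
    b²≤bˡ : b * b ≤ b ^ l
    b²≤bˡ = ≤-trans (≤-reflexive (cong (b *_) (sym (*-identityʳ b)))) (^-monoʳ-≤ b 2≤l)
    A<c : A < c
    A<c = <-≤-trans (n<B^length A) (≤-reflexive (trans (cong (c ^_) m≡1) (*-identityʳ c)))
    split : Dec (c ≤ k * k + k) → ⊥
    split (yes c≤k²+k) = second-convergent-beyond-truncation 2≤k k²<b b≤A (<-≤-trans A<c c≤k²+k) b²≤bˡ
                           (second-convergent≤truncation b-trott)
      where
      2≤k : 2 ≤ k
      2≤k = +-cancelˡ-≤ (k * k) 2 k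
              (≤-trans (≤-reflexive (+-comm (k * k) 2)) (≤-trans (≤-trans (s≤s k²<b) b<c) c≤k²+k))
    split (no c≰k²+k) = small-case-inconsistent {k} {A} {b} {c} {b ^ l} k²<b (s≤s (s≤s z≤n)) b≤A
                          (second-quotient≤k+1 {k} {A} {c} (≰⇒> c≰k²+k) second-convergent≤[k+1]/c)
                          second-convergent≤[k+1]/c b<c b²≤bˡ (B^length≤ 1≤A) (consistent-at m≡1)

  2≤m : 2 ≤ m
  2≤m = ≤∧≢⇒< (1≤length-digits 1≤A) (m≢1 ∘ sym)

  c≤k²+k : c ≤ k * k + k
  c≤k²+k = ≮⇒≥ λ k²+k<c → <⇒≱ k²+k<c (begin
    c          ≤⟨ base≤ 2≤m ⟩
    A          ≤⟨ second-quotient≤k+1 {k} {A} {c} k²+k<c second-convergent≤[k+1]/c ⟩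
    k + 1      ≡⟨ +-comm k 1 ⟩
    1 + k      ≤⟨ +-monoˡ-≤ k (*-mono-≤ 1≤k 1≤k) ⟩
    k * k + k  ∎)
    where open ≤-Reasoning

lemma6p5 : (b c : ℕ) (a : ℕ → ℕ) → 2 ≤ b → b < c →
    IsTrott b a → IsTrott c a →
    (∃[ k ] (1 ≤ k × (k * k + 1 ≤ b × b ≤ k * k + k) × (k * k + 1 ≤ c × c ≤ k * k + k)))
    × (2 ≤ length (digits c (a 2)) × length (digits c (a 2)) < length (digits b (a 2)))
lemma6p5 (suc zero) _          _ (s≤s ()) _
lemma6p5 (2+ b')    (suc zero) _ _        (s≤s ())
lemma6p5 (2+ b')    (2+ c')    a _        b<c b-trott c-trott =
  (k , 1≤k , (k²+1≤b , <⇒≤ (<-≤-trans b<c c≤k²+k)) , (≤-trans k²+1≤b (<⇒≤ b<c) , c≤k²+k)) ,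
  2≤m , m<l
  where
  open TwoBases b<c b-trott c-trott
  k²+1≤b : k * k + 1 ≤ b
  k²+1≤b = subst (_≤ b) (+-comm 1 (k * k)) k²<b
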